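{- For any cut-free derivations $f, g$ of the same sequent $S \mid \Gamma \vdash C$, if $f \circeq g$ then $\mathrm{focus}\, f = \mathrm{focus}\, g$.
   Context: Fix a set $\mathrm{Var}$ of atoms. Formulae: atoms $X \in \mathrm{Var}$, $\mathsf{I}$, and $A \otimes B$. A context is a finite list of formulae; a stoup $S$ is either empty ($-$) or a single formula; a stoup $T$ is irreducible if $T = -$ or $T$ is an atom. Cut-free sequent calculus: sequents $S \mid \Gamma \vdash C$ derived by (ax) $A \mid\ \vdash A$; (pass) from $A \mid \Gamma \vdash C$ infer $- \mid A, \Gamma \vdash C$; ($\mathsf I$L) from $- \mid \Gamma \vdash C$ infer $\mathsf I \mid \Gamma \vdash C$; ($\mathsf I$R) $- \mid\ \vdash \mathsf I$; ($\otimes$L) from $A \mid B, \Gamma \vdash C$ infer $A \otimes B \mid \Gamma \vdash C$; ($\otimes$R) from $S \mid \Gamma \vdash A$ and $- \mid \Delta \vdash B$ infer $S \mid \Gamma, \Delta \vdash A \otimes B$. The relation $\circeq$ is the least congruence on cut-free derivations (w.r.t. all rules) containing: $\mathrm{ax}_{\mathsf I} \circeq \mathsf{I}\mathrm{L}(\mathsf I\mathrm R)$; $\mathrm{ax}_{A \otimes B} \circeq \otimes\mathrm L(\otimes\mathrm R(\mathrm{ax}_A, \mathrm{pass}(\mathrm{ax}_B)))$; $\otimes\mathrm R(\mathrm{pass}\, f, g) \circeq \mathrm{pass}(\otimes\mathrm R(f, g))$; $\otimes\mathrm R(\mathsf I\mathrm L\, f, g) \circeq \mathsf I\mathrm L(\otimes\mathrm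 R(f, g))$; $\otimes\mathrm R(\otimes\mathrm L\, f, g) \circeq \otimes\mathrm L(\otimes\mathrm R(f, g))$. Focused calculus: sequents $S \mid \Gamma \vdash_{\mathsf L} C$ and $T \mid \Gamma \vdash_{\mathsf R} C$ ($T$ irreducible), derived by: (pass) from $A \mid \Gamma \vdash_{\mathsf L} C$ infer $- \mid A, \Gamma \vdash_{\mathsf L} C$; (switch) from $T \mid \Gamma \vdash_{\mathsf R} C$ infer $T \mid \Gamma \vdash_{\mathsf L} C$; (ax$_X$) $X \mid\ \vdash_{\mathsf R} X$ for atoms $X$; ($\mathsf I$L) from $- \mid \Gamma \vdash_{\mathsf L} C$ infer $\mathsf I \mid \Gamma \vdash_{\mathsf L} C$; ($\mathsf I$R$_{\mathsf R}$) $- \mid\ \vdash_{\mathsf R} \mathsf I$; ($\otimes$L) from $A \mid B, \Gamma \vdash_{\mathsf L} C$ infer $A \otimes B \mid \Gamma \vdash_{\mathsf L} C$; ($\otimes$R$_{\mathsf R}$) from $T \mid \Gamma \vdash_{\mathsf R} A$ and $- \mid \Delta \vdash_{\mathsf L} B$ infer $T \mid \Gamma, \Delta \vdash_{\mathsf R} A \otimes B$. $\mathrm{focus}$ maps cut-free derivations of $S \mid \Gamma \vdash C$ to focused derivations of $S \mid \Gamma \vdash_{\mathsf L} C$: $\mathrm{focus}(\mathrm{pass}\, f) = \mathrm{pass}(\mathrm{focus}\, f)$, $\mathrm{focus}(\mathsf I\mathrm L\, f) = \mathsf I\mathrm L(\mathrm{focus}\, f)$, $\mathrm{focus}(\otimes\mathrm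 L\, f) = \otimes\mathrm L(\mathrm{focus}\, f)$, $\mathrm{focus}(\mathsf I\mathrm R) = \mathrm{switch}(\mathsf I\mathrm R_{\mathsf R})$, $\mathrm{focus}(\otimes\mathrm R(f, g)) = \otimes\mathrm R_{\mathsf L}(\mathrm{focus}\, f, \mathrm{focus}\, g)$, $\mathrm{focus}(\mathrm{ax}_A) = \mathrm{ax}_{\mathsf L, A}$, where $\otimes\mathrm R_{\mathsf L}$ is defined by recursion on its first argument: $\otimes\mathrm R_{\mathsf L}(\mathrm{pass}\, f, g) = \mathrm{pass}(\otimes\mathrm R_{\mathsf L}(f, g))$, $\otimes\mathrm R_{\mathsf L}(\mathsf I\mathrm L\, f, g) = \mathsf I\mathrm L(\otimes\mathrm R_{\mathsf L}(f, g))$, $\otimes\mathrm R_{\mathsf L}(\otimes\mathrm L\, f, g) = \otimes\mathrm L(\otimes\mathrm R_{\mathsf L}(f, g))$, $\otimes\mathrm R_{\mathsf L}(\mathrm{switch}\, f, g) = \mathrm{switch}(\otimes\mathrm R_{\mathsf R}(f, g))$; and $\mathrm{ax}_{\mathsf L, X} = \mathrm{switch}(\mathrm{ax}_X)$, $\mathrm{ax}_{\mathsf L, \mathsf I} = \mathsf I\mathrm L(\mathrm{switch}(\mathsf I\mathrm R_{\mathsf R}))$, $\mathrm{ax}_{\mathsf L, A \otimes B} = \otimes\mathrm L(\otimes\mathrm R_{\mathsf L}(\mathrm{ax}_{\mathsf L, A}, \mathrm{pass}(\mathrm{ax}_{\mathsf L, B})))$. -}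

module Defs where

open import Data.List using (List; []; _∷_; _++_)
open import Data.Maybe using (Maybe; just; nothing)
open import Relation.Binary.PropositionalEquality using (_≡_; refl)

data Fma (Var : Set) : Set where
  ` : Var → Fma Var
  I : Fma Var
  _⊗_ : Fma Var → Fma Var → Fma Var

infixl 30 _⊗_

-- Contexts and stoups (nothing = empty stoup "-")
Cxt : Set → Set
Cxt Var = List (Fma Var)

Stp : Set → Set
Stp Var = Maybe (Fma Var)

data Irr {Var : Set} : Stp Var → Set where
  irr-  : Irr nothing
  irr-at : (X : Var) → Irr (just (` X))

infix 15 _∣_⊢_
data _∣_⊢_ {Var : Set} : Stp Var → Cxt Var → Fma Var → Set where
  ax   : {A : Fma Var} → just A ∣ [] ⊢ A
  pass : {Γ : Cxt Var} {A C : Fma Var} → just A ∣ Γ ⊢ C → nothing ∣ A ∷ Γ ⊢ C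
  IL   : {Γ : Cxt Var} {C : Fma Var} → nothing ∣ Γ ⊢ C → just I ∣ Γ ⊢ C
  IR   : nothing ∣ [] ⊢ I
  ⊗L   : {Γ : Cxt Var} {A B C : Fma Var} → just A ∣ B ∷ Γ ⊢ C → just (A ⊗ B) ∣ Γ ⊢ C
  ⊗R   : {S : Stp Var} {Γ Δ : Cxt Var} {A B : Fma Var} →
         S ∣ Γ ⊢ A → nothing ∣ Δ ⊢ B → S ∣ Γ ++ Δ ⊢ A ⊗ B

infix 5 _≗_
data _≗_ {Var : Set} : {S : Stp Var} {Γ : Cxt Var} {C : Fma Var} →
         S ∣ Γ ⊢ C → S ∣ Γ ⊢ C → Set where
  refl≗ : ∀ {S Γ C} {f : S ∣ Γ ⊢ C} → f ≗ f
  ~_    : ∀ {S Γ C} {f g : S ∣ Γ ⊢ C} → f ≗ g → g ≗ f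
  _∙_   : ∀ {S Γ C} {f g h : S ∣ Γ ⊢ C} → f ≗ g → g ≗ h → f ≗ h
  pass  : ∀ {Γ A C} {f g : just A ∣ Γ ⊢ C} → f ≗ g → pass f ≗ pass g
  IL    : ∀ {Γ C} {f g : nothing ∣ Γ ⊢ C} → f ≗ g → IL f ≗ IL g
  ⊗L    : ∀ {Γ A B C} {f g : just A ∣ B ∷ Γ ⊢ C} → f ≗ g → ⊗L f ≗ ⊗L g
  ⊗R    : ∀ {S Γ Δ A B} {f g : S ∣ Γ ⊢ A} {f' g' : nothing ∣ Δ ⊢ B} →
          f ≗ g → f' ≗ g' → ⊗R f f' ≗ ⊗R g g'
  axI   : ax ≗ IL IR
  ax⊗   : ∀ {A B} → ax {A = A ⊗ B} ≗ ⊗L (⊗R ax (pass ax))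
  ⊗Rpass : ∀ {Γ Δ A A' B} {f : just A' ∣ Γ ⊢ A} {g : nothing ∣ Δ ⊢ B} →
           ⊗R (pass f) g ≗ pass (⊗R f g)
  ⊗RIL  : ∀ {Γ Δ A B} {f : nothing ∣ Γ ⊢ A} {g : nothing ∣ Δ ⊢ B} →
          ⊗R (IL f) g ≗ IL (⊗R f g)
  ⊗R⊗L  : ∀ {Γ Δ A A' B' B} {f : just A' ∣ B' ∷ Γ ⊢ A} {g : nothing ∣ Δ ⊢ B} →
          ⊗R (⊗L f) g ≗ ⊗L (⊗R f g)

infix 15 _∣_⊢L_ _∣_⊢R_
data _∣_⊢L_ {Var : Set} : Stp Var → Cxt Var → Fma Var → Set
data _∣_⊢R_ {Var : Set} : Stp Var → Cxt Var → Fma Var → Set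

data _∣_⊢L_ {Var} where
  pass   : {Γ : Cxt Var} {A C : Fma Var} → just A ∣ Γ ⊢L C → nothing ∣ A ∷ Γ ⊢L C
  switch : {T : Stp Var} → Irr T → {Γ : Cxt Var} {C : Fma Var} →
           T ∣ Γ ⊢R C → T ∣ Γ ⊢L C
  IL     : {Γ : Cxt Var} {C : Fma Var} → nothing ∣ Γ ⊢L C → just I ∣ Γ ⊢L C
  ⊗L     : {Γ : Cxt Var} {A B C : Fma Var} → just A ∣ B ∷ Γ ⊢L C → just (A ⊗ B) ∣ Γ ⊢L C

data _∣_⊢R_ {Var} where
  ax  : {X : Var} → just (` X) ∣ [] ⊢R ` X
  IR  : nothing ∣ [] ⊢R I
  ⊗R  : {T : Stp Var} → Irr T → {Γ Δ : Cxt Var} {A B : Fma Var} →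
        T ∣ Γ ⊢R A → nothing ∣ Δ ⊢L B → T ∣ Γ ++ Δ ⊢R A ⊗ B

⊗RL : {Var : Set} {S : Stp Var} {Γ Δ : Cxt Var} {A B : Fma Var} →
      S ∣ Γ ⊢L A → nothing ∣ Δ ⊢L B → S ∣ Γ ++ Δ ⊢L A ⊗ B
⊗RL (pass f) g = pass (⊗RL f g)
⊗RL (IL f) g = IL (⊗RL f g)
⊗RL (⊗L f) g = ⊗L (⊗RL f g)
⊗RL (switch t f) g = switch t (⊗R t f g)

axL : {Var : Set} {A : Fma Var} → just A ∣ [] ⊢L A
axL {A = ` X} = switch (irr-at X) ax
axL {A = I} = IL (switch irr- IR)
axL {A = A ⊗ B} = ⊗L (⊗RL axL (pass axL))

focus : {Var : Set} {S : Stp Var} {Γ : Cxt Var} {C : Fma Var} →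
        S ∣ Γ ⊢ C → S ∣ Γ ⊢L C
focus ax = axL
focus (pass f) = pass (focus f)
focus (IL f) = IL (focus f)
focus IR = switch irr- IR
focus (⊗L f) = ⊗L (focus f)
focus (⊗R f g) = ⊗RL (focus f) (focus g)

module Submission where

open import Defs
open import Relation.Binary.PropositionalEquality using (_≡_; refl; sym; trans; cong; cong₂)

-- The five generating equations of ≗ hold definitionally: focus unfolds ax
-- to axL and ⊗R to ⊗RL, whose defining clauses are exactly these equations.
focus-resp-≗ : {Var : Set} {S : Stp Var} {Γ : Cxt Var} {C : Fma Var}
               {f g : S ∣ Γ ⊢ C} → f ≗ g → focus f ≡ focus g
focus-resp-≗ refl≗ = refl
focus-resp-≗ (~ p) = sym (focus-resp-≗ p)
focus-resp-≗ (p ∙ q) = trans (focus-resp-≗ p) (focus-resp-≗ q)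
focus-resp-≗ (pass p) = cong pass (focus-resp-≗ p)
focus-resp-≗ (IL p) = cong IL (focus-resp-≗ p)
focus-resp-≗ (⊗L p) = cong ⊗L (focus-resp-≗ p)
focus-resp-≗ (⊗R p q) = cong₂ ⊗RL (focus-resp-≗ p) (focus-resp-≗ q)
focus-resp-≗ axI = refl
focus-resp-≗ ax⊗ = refl
focus-resp-≗ ⊗Rpass = refl
focus-resp-≗ ⊗RIL = refl
focus-resp-≗ ⊗R⊗L = refl

lemma5p5 : {Var : Set} {S : Stp Var} {Γ : Cxt Var} {C : Fma Var} →
    (f g : S ∣ Γ ⊢ C) → f ≗ g → focus f ≡ focus g
lemma5p5 _ _ = focus-resp-≗
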